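{- Let $k\ge 3$, $m\ge 5$, and let $n$ be a positive integer. Suppose $a_1<a_2<\cdots<a_m$ are natural numbers with $n^3\le a_1$ such that the set $\{a_1,\ldots,a_m\}$ has property $D_k(-n)$. Then $a_{2+3j}\geq a_2^{(k-1)^j}$ for every integer $j$ with $1\le j\le (m-2)/3$.
   Context: A set of natural numbers $S$ has property $D_k(N)$ (for a non-zero integer $N$) if $xy+N$ is a perfect $k$-th power for all distinct $x,y\in S$. Here $N=-n$, i.e. $xy-n$ is a perfect $k$-th power for all distinct $x,y\in S$. -}

module Defs where

open import Data.Nat using (ℕ; _≤_; _<_; _*_)
open import Data.Integer as ℤ using (ℤ; +_; _-_; _^_)
open import Data.Product using (∃)
open import Relation.Binary.PropositionalEquality using (_≡_; _≢_)

IsPerfectPower : ℕ → ℤ → Set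
IsPerfectPower k w = ∃ λ (z : ℤ) → w ≡ z ^ k

HasDk-neg : (k n m : ℕ) → (ℕ → ℕ) → Set
HasDk-neg k n m a =
  ∀ i j → 1 ≤ i → i ≤ m → 1 ≤ j → j ≤ m → a i ≢ a j →
  IsPerfectPower k (+ (a i * a j) - + n)

{-# OPTIONS --safe #-}
module Submission where

-- For a < b ≤ c < d in a D_k(-n) set the four numbers ac−n, bd−n, ad−n, bc−n are k-th powers, and
--   (ad−n)(bc−n) = (ac−n)(bd−n) + n(b−a)(d−c).
-- So two k-th powers X^k > Y^k differ by D = n(b−a)(d−c) ≤ n·bd, whence D ≥ k·Y^(k−1) by the binomial
-- theorem. As Y^k = (ac−n)(bd−n) ≥ ac·bd/4 and 4^(k−1) ≤ k^k, this gives (ac)^(k−1) ≤ n^k·bd, and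
-- n³ ≤ a ≤ c turns it into a^(k−1) ≤ d. Applied to four consecutive terms, a_(i+3) ≥ a_i^(k−1);
-- iterating from i = 2 in steps of 3 gives the bound.

open import Defs
open import Data.Nat using (ℕ; zero; suc; _≤_; _<_; _≥_; _+_; _*_; _^_; _∸_; s≤s; z≤n; >-nonZero)
open import Data.Nat.Properties
open import Data.Nat.Tactic.RingSolver using (solve-∀)
open import Data.Integer as ℤ using (+_; ∣_∣)
import Data.Integer.Properties as ℤ
open import Data.Product using (_,_)
open import Relation.Binary.PropositionalEquality

^-distrib-* : ∀ x y n → (x * y) ^ n ≡ x ^ n * y ^ n
^-distrib-* x y zero    = refl
^-distrib-* x y (suc n) = begin
  x * y * (x * y) ^ n      ≡⟨ cong (x * y *_) (^-distrib-* x y n) ⟩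
  x * y * (x ^ n * y ^ n)  ≡⟨ [m*n]*[o*p]≡[m*o]*[n*p] x y (x ^ n) (y ^ n) ⟩
  x ^ suc n * y ^ suc n    ∎
  where open ≡-Reasoning

^-swap : ∀ x m n → (x ^ m) ^ n ≡ (x ^ n) ^ m
^-swap x m n = begin
  (x ^ m) ^ n  ≡⟨ ^-*-assoc x m n ⟩
  x ^ (m * n)  ≡⟨ cong (x ^_) (*-comm m n) ⟩
  x ^ (n * m)  ≡⟨ ^-*-assoc x n m ⟨
  (x ^ n) ^ m  ∎
  where open ≡-Reasoning

binomial-lower-bound : ∀ y k → y ^ suc k + suc k * y ^ k ≤ suc y ^ suc k
binomial-lower-bound y zero    = ≤-reflexive (base y)
  where
  base : ∀ y → y * 1 + 1 * 1 ≡ (1 + y) * 1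
  base = solve-∀
binomial-lower-bound y (suc k) = begin
  y ^ suc (suc k) + suc (suc k) * y ^ suc k
    ≤⟨ m≤m+n _ _ ⟩
  y ^ suc (suc k) + suc (suc k) * y ^ suc k + suc k * y ^ k
    ≡⟨ expand y (y ^ k) k ⟨
  suc y * (y ^ suc k + suc k * y ^ k)
    ≤⟨ *-monoʳ-≤ (suc y) (binomial-lower-bound y k) ⟩
  suc y ^ suc (suc k) ∎
  where
  open ≤-Reasoning
  expand : ∀ y w k → (1 + y) * (y * w + (1 + k) * w) ≡ y * (y * w) + (2 + k) * (y * w) + (1 + k) * w
  expand = solve-∀

4^k≤[1+k]^[1+k] : ∀ k → 4 ^ k ≤ suc k ^ suc k
4^k≤[1+k]^[1+k] zero                = ≤-refl
4^k≤[1+k]^[1+k] (suc zero)          = ≤-refl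
4^k≤[1+k]^[1+k] (suc (suc zero))    = m≤m+n 16 11
4^k≤[1+k]^[1+k] k@(suc (suc (suc _))) = begin
  4 ^ k          ≤⟨ ^-monoˡ-≤ k (s≤s (s≤s (s≤s (s≤s z≤n)))) ⟩
  suc k ^ k      ≤⟨ ^-monoʳ-≤ (suc k) (n≤1+n k) ⟩
  suc k ^ suc k  ∎
  where open ≤-Reasoning

^-gap : ∀ k x y {d} → x ^ suc k ≡ y ^ suc k + d → 1 ≤ d → suc k * y ^ k ≤ d
^-gap k x y {d} x^K≡y^K+d 1≤d = +-cancelˡ-≤ (y ^ suc k) _ _ (begin
  y ^ suc k + suc k * y ^ k  ≤⟨ binomial-lower-bound y k ⟩
  suc y ^ suc k              ≤⟨ ^-monoˡ-≤ (suc k) y<x ⟩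
  x ^ suc k                  ≡⟨ x^K≡y^K+d ⟩
  y ^ suc k + d              ∎)
  where
  open ≤-Reasoning
  y<x : y < x
  y<x = ≰⇒> λ x≤y → <⇒≱ (subst (y ^ suc k <_) (sym x^K≡y^K+d) (m<m+n (y ^ suc k) 1≤d))
                         (^-monoˡ-≤ (suc k) x≤y)

^-gap-pow : ∀ k x y {d} → x ^ suc k ≡ y ^ suc k + d → 1 ≤ d →
  suc k ^ suc k * (y ^ suc k) ^ k ≤ d ^ suc k
^-gap-pow k x y {d} x^K≡y^K+d 1≤d = begin
  suc k ^ suc k * (y ^ suc k) ^ k  ≡⟨ cong (suc k ^ suc k *_) (^-swap y (suc k) k) ⟩
  suc k ^ suc k * (y ^ k) ^ suc k  ≡⟨ ^-distrib-* (suc k) (y ^ k) (suc k) ⟨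
  (suc k * y ^ k) ^ suc k          ≤⟨ ^-monoˡ-≤ (suc k) (^-gap k x y x^K≡y^K+d 1≤d) ⟩
  d ^ suc k                        ∎
  where open ≤-Reasoning

∣i^n∣≡∣i∣^n : ∀ i n → ∣ i ℤ.^ n ∣ ≡ ∣ i ∣ ^ n
∣i^n∣≡∣i∣^n i zero    = refl
∣i^n∣≡∣i∣^n i (suc n) = trans (ℤ.abs-* i (i ℤ.^ n)) (cong (∣ i ∣ *_) (∣i^n∣≡∣i∣^n i n))

perfectPower-∸ : ∀ {x n} k z → n ≤ x → + x ℤ.- + n ≡ z ℤ.^ k → x ∸ n ≡ ∣ z ∣ ^ k
perfectPower-∸ {x} {n} k z n≤x x-n≡z^k = begin
  x ∸ n                ≡⟨⟩
  ∣ + (x ∸ n) ∣        ≡⟨ cong ∣_∣ (ℤ.≤-⊖ n≤x) ⟨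
  ∣ x ℤ.⊖ n ∣          ≡⟨ cong ∣_∣ (ℤ.[+m]-[+n]≡m⊖n x n) ⟨
  ∣ + x ℤ.- + n ∣      ≡⟨ cong ∣_∣ x-n≡z^k ⟩
  ∣ z ℤ.^ k ∣          ≡⟨ ∣i^n∣≡∣i∣^n z k ⟩
  ∣ z ∣ ^ k            ∎
  where open ≡-Reasoning

x≤2[x∸n] : ∀ {x} n → 2 * n ≤ x → x ≤ 2 * (x ∸ n)
x≤2[x∸n] {x} n 2n≤x = begin
  x                  ≡⟨ m∸n+n≡m (m+n≤o⇒n≤o n n+n≤x) ⟨
  (x ∸ n) + n        ≤⟨ +-monoʳ-≤ (x ∸ n) (m+n≤o⇒m≤o∸n n n+n≤x) ⟩
  (x ∸ n) + (x ∸ n)  ≡⟨ cong (_+_ (x ∸ n)) (+-identityʳ (x ∸ n)) ⟨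
  2 * (x ∸ n)        ∎
  where
  open ≤-Reasoning
  n+n≤x : n + n ≤ x
  n+n≤x = subst (_≤ x) (cong (_+_ n) (+-identityʳ n)) 2n≤x

products-identity : ∀ n {a b c d} → a ≤ b → c ≤ d → n ≤ a * c →
  (a * d ∸ n) * (b * c ∸ n) ≡ (a * c ∸ n) * (b * d ∸ n) + n * (b ∸ a) * (d ∸ c)
products-identity n {a} {b} {c} {d} a≤b c≤d n≤ac = begin
  (a * d ∸ n) * (b * c ∸ n)
    ≡⟨ cong₂ _*_ (shift (a * q) ad≡) (shift (p * c) bc≡) ⟩
  (α + a * q) * (α + p * c)
    ≡⟨ expand α a c p q ⟩
  α * (α + a * q + p * c) + a * c * (p * q)
    ≡⟨ cong (λ z → α * (α + a * q + p * c) + z * (p * q)) (m∸n+n≡m n≤ac) ⟨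
  α * (α + a * q + p * c) + (α + n) * (p * q)
    ≡⟨ regroup α n a c p q ⟩
  α * (α + (a * q + p * c + p * q)) + n * p * q
    ≡⟨ cong (λ z → α * z + n * p * q) (shift (a * q + p * c + p * q) bd≡) ⟨
  α * (b * d ∸ n) + n * p * q ∎
  where
  open ≡-Reasoning
  p q α : ℕ
  p = b ∸ a
  q = d ∸ c
  α = a * c ∸ n
  shift : ∀ y {x} → x ≡ a * c + y → x ∸ n ≡ α + y
  shift y refl = +-∸-comm y n≤ac
  b≡a+p : b ≡ a + p
  b≡a+p = sym (m+[n∸m]≡n a≤b)
  d≡c+q : d ≡ c + q
  d≡c+q = sym (m+[n∸m]≡n c≤d)
  ad≡ : a * d ≡ a * c + a * q
  ad≡ = trans (cong (a *_) d≡c+q) (*-distribˡ-+ a c q)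
  bc≡ : b * c ≡ a * c + p * c
  bc≡ = trans (cong (_* c) b≡a+p) (*-distribʳ-+ c a p)
  bd≡ : b * d ≡ a * c + (a * q + p * c + p * q)
  bd≡ = trans (cong₂ _*_ b≡a+p d≡c+q) (multiply a c p q)
    where
    multiply : ∀ a c p q → (a + p) * (c + q) ≡ a * c + (a * q + p * c + p * q)
    multiply = solve-∀
  expand : ∀ α a c p q → (α + a * q) * (α + p * c) ≡ α * (α + a * q + p * c) + a * c * (p * q)
  expand = solve-∀
  regroup : ∀ α n a c p q →
    α * (α + a * q + p * c) + (α + n) * (p * q) ≡ α * (α + (a * q + p * c + p * q)) + n * p * q
  regroup = solve-∀

product-bound : ∀ k n {a b c d} → 1 ≤ n → a < b → c < d → 2 * n ≤ a * c →
  IsPerfectPower (suc k) (+ (a * c) ℤ.- + n) → IsPerfectPower (suc k) (+ (b * d) ℤ.- + n) →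
  IsPerfectPower (suc k) (+ (a * d) ℤ.- + n) → IsPerfectPower (suc k) (+ (b * c) ℤ.- + n) →
  (a * c) ^ k ≤ n ^ suc k * (b * d)
product-bound k n {a} {b} {c} {d} 1≤n a<b c<d 2n≤ac (s , ac-n) (t , bd-n) (u , ad-n) (v , bc-n) =
  *-cancelʳ-≤ _ _ ((b * d) ^ k) {{m^n≢0 (b * d) k {{>-nonZero (≤-trans 1≤n n≤bd)}}}} (begin
    (a * c) ^ k * (b * d) ^ k      ≡⟨ ^-distrib-* (a * c) (b * d) k ⟨
    (a * c * (b * d)) ^ k          ≤⟨ ^-monoˡ-≤ k (*-mono-≤ (x≤2[x∸n] n 2n≤ac) (x≤2[x∸n] n 2n≤bd)) ⟩
    (2 * α * (2 * β)) ^ k          ≡⟨ cong (_^ k) (double-product α β) ⟩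
    (4 * (α * β)) ^ k              ≡⟨ ^-distrib-* 4 (α * β) k ⟩
    4 ^ k * (α * β) ^ k            ≤⟨ *-monoˡ-≤ ((α * β) ^ k) (4^k≤[1+k]^[1+k] k) ⟩
    K ^ K * (α * β) ^ k            ≡⟨ cong (λ z → K ^ K * z ^ k) Y^K≡αβ ⟨
    K ^ K * (Y ^ K) ^ k            ≤⟨ ^-gap-pow k X Y X^K≡Y^K+D 1≤D ⟩
    D ^ K                          ≤⟨ ^-monoˡ-≤ K D≤n[bd] ⟩
    (n * (b * d)) ^ K              ≡⟨ ^-distrib-* n (b * d) K ⟩
    n ^ K * (b * d * (b * d) ^ k)  ≡⟨ *-assoc (n ^ K) (b * d) ((b * d) ^ k) ⟨
    n ^ K * (b * d) * (b * d) ^ k  ∎)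
  where
  open ≤-Reasoning
  K α β D X Y : ℕ
  K = suc k
  α = a * c ∸ n
  β = b * d ∸ n
  D = n * (b ∸ a) * (d ∸ c)
  X = ∣ u ∣ * ∣ v ∣
  Y = ∣ s ∣ * ∣ t ∣
  a≤b : a ≤ b
  a≤b = <⇒≤ a<b
  c≤d : c ≤ d
  c≤d = <⇒≤ c<d
  ac≤bd : a * c ≤ b * d
  ac≤bd = *-mono-≤ a≤b c≤d
  2n≤bd : 2 * n ≤ b * d
  2n≤bd = ≤-trans 2n≤ac ac≤bd
  n≤ac : n ≤ a * c
  n≤ac = ≤-trans (m≤n*m n 2) 2n≤ac
  n≤bd : n ≤ b * d
  n≤bd = ≤-trans n≤ac ac≤bd
  n≤ad : n ≤ a * d
  n≤ad = ≤-trans n≤ac (*-monoʳ-≤ a c≤d)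
  n≤bc : n ≤ b * c
  n≤bc = ≤-trans n≤ac (*-monoˡ-≤ c a≤b)
  Y^K≡αβ : Y ^ K ≡ α * β
  Y^K≡αβ = trans (^-distrib-* ∣ s ∣ ∣ t ∣ K)
    (sym (cong₂ _*_ (perfectPower-∸ K s n≤ac ac-n) (perfectPower-∸ K t n≤bd bd-n)))
  X^K≡Y^K+D : X ^ K ≡ Y ^ K + D
  X^K≡Y^K+D = ≡.begin
    X ^ K                      ≡.≡⟨ ^-distrib-* ∣ u ∣ ∣ v ∣ K ⟩
    ∣ u ∣ ^ K * ∣ v ∣ ^ K      ≡.≡⟨ cong₂ _*_ (perfectPower-∸ K u n≤ad ad-n) (perfectPower-∸ K v n≤bc bc-n) ⟨
    (a * d ∸ n) * (b * c ∸ n)  ≡.≡⟨ products-identity n a≤b c≤d n≤ac ⟩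
    α * β + D                  ≡.≡⟨ cong (_+ D) Y^K≡αβ ⟨
    Y ^ K + D                  ≡.∎
    where module ≡ = ≡-Reasoning
  1≤D : 1 ≤ D
  1≤D = *-mono-≤ (*-mono-≤ 1≤n (m<n⇒0<n∸m a<b)) (m<n⇒0<n∸m c<d)
  D≤n[bd] : D ≤ n * (b * d)
  D≤n[bd] = ≤-trans (*-mono-≤ (*-monoʳ-≤ n (m∸n≤m b a)) (m∸n≤m d c)) (≤-reflexive (*-assoc n b d))
  double-product : ∀ x y → 2 * x * (2 * y) ≡ 4 * (x * y)
  double-product = solve-∀

cube≤⇒^≤ : ∀ k {n c} → 1 ≤ n → n ^ 3 ≤ c → n ^ (3 + k) ≤ c ^ (1 + k)
cube≤⇒^≤ k {n} {c} 1≤n n³≤c = begin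
  n ^ (3 + k)        ≤⟨ ^-monoʳ-≤ n {{>-nonZero 1≤n}} 3+k≤3[1+k] ⟩
  n ^ (3 * (1 + k))  ≡⟨ ^-*-assoc n 3 (1 + k) ⟨
  (n ^ 3) ^ (1 + k)  ≤⟨ ^-monoˡ-≤ (1 + k) n³≤c ⟩
  c ^ (1 + k)        ∎
  where
  open ≤-Reasoning
  3+k≤3[1+k] : 3 + k ≤ 3 * (1 + k)
  3+k≤3[1+k] = ≤-trans (+-monoʳ-≤ 3 (m≤n*m k 3)) (≤-reflexive (sym (*-suc 3 k)))

four-term-gap : ∀ k n {a b c d} → 1 ≤ n → n ^ 3 ≤ a → a < b → b ≤ c → c < d →
  IsPerfectPower (3 + k) (+ (a * c) ℤ.- + n) → IsPerfectPower (3 + k) (+ (b * d) ℤ.- + n) →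
  IsPerfectPower (3 + k) (+ (a * d) ℤ.- + n) → IsPerfectPower (3 + k) (+ (b * c) ℤ.- + n) →
  a ^ (2 + k) ≤ d
four-term-gap k n {a} {b} {c} {d} 1≤n n³≤a a<b b≤c c<d ac-n bd-n ad-n bc-n =
  *-cancelˡ-≤ (c ^ (2 + k)) {{m^n≢0 c (2 + k) {{>-nonZero (≤-trans 1≤n n≤c)}}}} (begin
    c ^ (2 + k) * a ^ (2 + k)      ≡⟨ *-comm (c ^ (2 + k)) (a ^ (2 + k)) ⟩
    a ^ (2 + k) * c ^ (2 + k)      ≡⟨ ^-distrib-* a c (2 + k) ⟨
    (a * c) ^ (2 + k)              ≤⟨ product-bound (2 + k) n 1≤n a<b c<d 2n≤ac ac-n bd-n ad-n bc-n ⟩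
    n ^ (3 + k) * (b * d)          ≤⟨ *-mono-≤ (cube≤⇒^≤ k 1≤n n³≤c) (*-monoˡ-≤ d b≤c) ⟩
    c ^ (1 + k) * (c * d)          ≡⟨ swap-assoc (c ^ (1 + k)) c d ⟩
    c ^ (2 + k) * d                ∎)
  where
  open ≤-Reasoning
  n≤a : n ≤ a
  n≤a = ≤-trans (≤-trans (≤-reflexive (sym (^-identityʳ n))) (^-monoʳ-≤ n {{>-nonZero 1≤n}} {1} {3} (s≤s z≤n))) n³≤a
  n≤c : n ≤ c
  n≤c = ≤-trans n≤a (≤-trans (<⇒≤ a<b) b≤c)
  n³≤c : n ^ 3 ≤ c
  n³≤c = ≤-trans n³≤a (≤-trans (<⇒≤ a<b) b≤c)
  2≤c : 2 ≤ c
  2≤c = ≤-trans (s≤s (≤-trans 1≤n n≤a)) (≤-trans a<b b≤c)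
  2n≤ac : 2 * n ≤ a * c
  2n≤ac = subst (_≤ a * c) (*-comm n 2) (*-mono-≤ n≤a 2≤c)
  swap-assoc : ∀ x y z → x * (y * z) ≡ y * x * z
  swap-assoc = solve-∀

^-iterate-≤ : (f : ℕ → ℕ) (e s r m : ℕ) →
  (∀ i → r ≤ i → s + i ≤ m → f i ^ e ≤ f (s + i)) →
  ∀ j → j * s + r ≤ m → f r ^ (e ^ j) ≤ f (j * s + r)
^-iterate-≤ f e s r m step zero    _   = ≤-reflexive (*-identityʳ (f r))
^-iterate-≤ f e s r m step (suc j) j′≤m = begin
  f r ^ (e * e ^ j)      ≡⟨ cong (f r ^_) (*-comm e (e ^ j)) ⟩
  f r ^ (e ^ j * e)      ≡⟨ ^-*-assoc (f r) (e ^ j) e ⟨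
  (f r ^ (e ^ j)) ^ e    ≤⟨ ^-monoˡ-≤ e (^-iterate-≤ f e s r m step j (m+n≤o⇒n≤o s s+i≤m)) ⟩
  f i ^ e                ≤⟨ step i (m≤n+m r (j * s)) s+i≤m ⟩
  f (s + i)              ≡⟨ cong f (+-assoc s (j * s) r) ⟨
  f (suc j * s + r)      ∎
  where
  open ≤-Reasoning
  i : ℕ
  i = j * s + r
  s+i≤m : s + i ≤ m
  s+i≤m = subst (_≤ m) (+-assoc s (j * s) r) j′≤m

module _ {m : ℕ} {a : ℕ → ℕ} (increasing : ∀ i → 1 ≤ i → i < m → a i < a (i + 1)) where

  a[i]<a[1+i] : ∀ {i} → 1 ≤ i → 1 + i ≤ m → a i < a (1 + i)
  a[i]<a[1+i] {i} 1≤i 1+i≤m = subst (λ j → a i < a j) (+-comm i 1) (increasing i 1≤i 1+i≤m)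

  a[1]≤a[i] : ∀ {i} → 1 ≤ i → i ≤ m → a 1 ≤ a i
  a[1]≤a[i] {suc zero}    _ _   = ≤-refl
  a[1]≤a[i] {suc (suc i)} _ i≤m =
    ≤-trans (a[1]≤a[i] (s≤s z≤n) (≤-trans (n≤1+n _) i≤m)) (<⇒≤ (a[i]<a[1+i] (s≤s z≤n) i≤m))

  Dk-gap : ∀ k n → 1 ≤ n → n ^ 3 ≤ a 1 → HasDk-neg (3 + k) n m a →
    ∀ i → 1 ≤ i → 3 + i ≤ m → a i ^ (2 + k) ≤ a (3 + i)
  Dk-gap k n 1≤n n³≤a₁ Dk i 1≤i 3+i≤m =
    four-term-gap k n 1≤n (≤-trans n³≤a₁ (a[1]≤a[i] 1≤i i≤m)) a₀<a₁ (<⇒≤ a₁<a₂) a₂<a₃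
      (Dk i (2 + i) 1≤i i≤m (s≤s z≤n) 2+i≤m (<⇒≢ (<-trans a₀<a₁ a₁<a₂)))
      (Dk (1 + i) (3 + i) (s≤s z≤n) 1+i≤m (s≤s z≤n) 3+i≤m (<⇒≢ (<-trans a₁<a₂ a₂<a₃)))
      (Dk i (3 + i) 1≤i i≤m (s≤s z≤n) 3+i≤m (<⇒≢ (<-trans a₀<a₁ (<-trans a₁<a₂ a₂<a₃))))
      (Dk (1 + i) (2 + i) (s≤s z≤n) 1+i≤m (s≤s z≤n) 2+i≤m (<⇒≢ a₁<a₂))
    where
    2+i≤m : 2 + i ≤ m
    2+i≤m = ≤-trans (n≤1+n _) 3+i≤m
    1+i≤m : 1 + i ≤ m
    1+i≤m = ≤-trans (n≤1+n _) 2+i≤m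
    i≤m : i ≤ m
    i≤m = ≤-trans (n≤1+n _) 1+i≤m
    a₀<a₁ : a i < a (1 + i)
    a₀<a₁ = a[i]<a[1+i] 1≤i 1+i≤m
    a₁<a₂ : a (1 + i) < a (2 + i)
    a₁<a₂ = a[i]<a[1+i] (s≤s z≤n) 2+i≤m
    a₂<a₃ : a (2 + i) < a (3 + i)
    a₂<a₃ = a[i]<a[1+i] (s≤s z≤n) 3+i≤m

corollary2p10 : (k m n : ℕ) → k ≥ 3 → m ≥ 5 → 1 ≤ n →
    (a : ℕ → ℕ) →
    (∀ i → 1 ≤ i → i < m → a i < a (i + 1)) →
    n ^ 3 ≤ a 1 →
    HasDk-neg k n m a →
    ∀ j → 1 ≤ j → 2 + 3 * j ≤ m →
    a 2 ^ ((k ∸ 1) ^ j) ≤ a (2 + 3 * j)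
corollary2p10 (suc (suc (suc k))) m n (s≤s (s≤s (s≤s _))) _ 1≤n a increasing n³≤a₁ Dk j _ 2+3j≤m =
  subst (λ i → a 2 ^ ((2 + k) ^ j) ≤ a i) (index j)
    (^-iterate-≤ a (2 + k) 3 2 m step j (subst (_≤ m) (sym (index j)) 2+3j≤m))
  where
  step : ∀ i → 2 ≤ i → 3 + i ≤ m → a i ^ (2 + k) ≤ a (3 + i)
  step i 2≤i = Dk-gap increasing k n 1≤n n³≤a₁ Dk i (≤-trans (n≤1+n 1) 2≤i)
  index : ∀ j → j * 3 + 2 ≡ 2 + 3 * j
  index = solve-∀
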